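{- If $G$ is a connected bipartite graph, then $\operatorname{hn}(G) \leq \operatorname{hn}(G_{C_4})$.
   Context: For an undirected graph $G$: $I_G(S)$ is the set of vertices lying on some shortest $u$–$v$ path with $u,v \in S$ (and $I_G(S)=S$ if $|S|\le 1$); $S$ is convex if $I_G(S)=S$; the hull of $S$ is the smallest convex set containing it; a hull set is a set whose hull is $V(G)$; $\operatorname{hn}(G)$ is the minimum size of a hull set. The same notions for an oriented graph $D$ are defined using directed geodesics (directed $(u,v)$-paths with minimum number of arcs, for all ordered pairs $u,v\in S$), giving $\operatorname{hn}(D)$. Given a graph $G$ with $V(G)=\{v_1,\dots,v_n\}$, $G_{C_4}$ is the oriented graph with vertex set $V(G) \cup \{v_{i,j}, v_{j,i} : v_iv_j \in E(G)\}$ and arc set $\{(v_i,v_{i,j}),(v_{i,j},v_j),(v_j,v_{j,i}),(v_{j,i},v_i) : v_iv_j \in E(G)\}$; i.e. each edge of $G$ is replaced by a directed $4$-cycle. -}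

module Defs where

open import Data.Nat using (ℕ; zero; suc; _≤_)
open import Data.Bool using (Bool; true; false)
open import Data.Fin using (Fin)
open import Data.List using (List; length)
open import Data.List.Membership.Propositional using (_∈_)
open import Data.List.Relation.Unary.Unique.Propositional using (Unique)
open import Data.Product using (Σ; ∃; _×_; _,_)
open import Relation.Binary.PropositionalEquality using (_≡_; _≢_)

record Graph (n : ℕ) : Set where
  field
    adj    : Fin n → Fin n → Bool
    sym    : ∀ i j → adj i j ≡ adj j i
    irrefl : ∀ i → adj i i ≡ false
open Graph public

Edge : ∀ {n} → Graph n → Fin n → Fin n → Set
Edge G i j = adj G i j ≡ true

-- Generic (directed) walks along a relation R; for a symmetric R these
-- are the walks of the undirected graph.

module _ {V : Set} (R : V → V → Set) where

  data Walk : V → V → ℕ → Set where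
    nil  : ∀ {u} → Walk u u 0
    cons : ∀ {u w v k} → R u w → Walk w v k → Walk u v (suc k)

  data OnWalk (x : V) : ∀ {u v k} → Walk u v k → Set where
    here  : ∀ {v k} {p : Walk x v k} → OnWalk x p
    there : ∀ {u w v k} {e : R u w} {p : Walk w v k} →
            OnWalk x p → OnWalk x (cons e p)

  IsGeodesic : ∀ {u v k} → Walk u v k → Set
  IsGeodesic {u} {v} {k} _ = ∀ k' → Walk u v k' → k ≤ k'

  Interval : (V → Set) → V → Set
  Interval S x = Σ V λ u → Σ V λ v → S u × S v ×
                 Σ ℕ λ k → Σ (Walk u v k) λ p → IsGeodesic p × OnWalk x p

  Convex : (V → Set) → Set
  Convex C = ∀ x → Interval C x → C x

  -- a finite set S (as a duplicate-free list) is a hull set iff its hull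
  -- (the intersection of all convex sets containing S) is all of V
  IsHullSet : List V → Set₁
  IsHullSet S = ∀ (C : V → Set) → Convex C → (∀ x → x ∈ S → C x) → ∀ x → C x

  IsHullNumber : ℕ → Set₁
  IsHullNumber h =
    (Σ (List V) λ S → Unique S × length S ≡ h × IsHullSet S) ×
    (∀ (S : List V) → Unique S → IsHullSet S → h ≤ length S)

Connected : ∀ {n} → Graph n → Set
Connected G = ∀ u v → Σ ℕ λ k → Walk (Edge G) u v k

Bipartite : ∀ {n} → Graph n → Set
Bipartite {n} G = Σ (Fin n → Bool) λ c → ∀ i j → Edge G i j → c i ≢ c j

data C4Vertex {n : ℕ} (G : Graph n) : Set where
  base : Fin n → C4Vertex G
  sub  : (i j : Fin n) → Edge G i j → C4Vertex G

data C4Arc {n : ℕ} (G : Graph n) : C4Vertex G → C4Vertex G → Set where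
  out : ∀ i j (e : Edge G i j) → C4Arc G (base i) (sub i j e)
  inn : ∀ i j (e : Edge G i j) → C4Arc G (sub i j e) (base j)

module Submission where

-- Every convex set C of G lifts to the set  Lift C  of vertices of G_{C4}
-- whose endpoints lie in C (the endpoints of v_i are v_i, v_i and those of
-- v_{i,j} are v_i, v_j).  Lift C is convex in G_{C4}, because a directed
-- geodesic leaving v_i runs through the 4-cycles of the edges of a geodesic
-- of G, two arcs per edge.  Consequently, if a hull set S of G_{C4} lies in
-- Lift C for every convex C ⊇ T, then T is a hull set of G.
--
-- For S = x, y, y₁, … such a T with |T| ≤ |S| consists of an anchor p (an
-- endpoint of x) and, for every other element of S, its endpoint farthest
-- from p.  Bipartiteness recovers the remaining endpoints: if s, a ∈ C and o
-- is adjacent to a with d(s,o) ≤ d(s,a), then d(s,a) = d(s,o) + 1, so o lies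
-- on a geodesic from s to a.  Choosing as anchor the endpoint of x that is
-- farther from the endpoints of y makes the other endpoint of x recoverable
-- too.

open import Defs
open import Data.Nat using (ℕ; zero; suc; _+_; _≤_; _<_; z≤n; s≤s; _≤?_)
open import Data.Nat.Properties
  using (≤-pred; ≮⇒≥; ≰⇒≥; ≤∧≢⇒<; ≤-antisym; ≤-refl; ≤-trans; ≤-reflexive; +-cancelʳ-≤; anyUpTo?; module ≤-Reasoning)
open import Data.Nat.Induction using (<-rec)
open import Data.Bool using (Bool; true; not)
open import Data.Bool.Properties using (¬-not; not-¬) renaming (_≟_ to _≟ᴮ_)
open import Data.Fin using (Fin) renaming (_≟_ to _≟ᶠ_)
open import Data.Fin.Properties using (any?)
open import Data.List using (List; []; _∷_; length; map; deduplicate)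
open import Data.List.Properties using (length-map; length-deduplicate)
open import Data.List.Membership.Propositional using (_∈_)
open import Data.List.Membership.Propositional.Properties using (∈-map⁺; ∈-deduplicate⁺)
import Data.List.Relation.Unary.Any as Any
open import Data.List.Relation.Unary.Unique.Propositional using (Unique)
open import Data.List.Relation.Unary.Unique.DecPropositional.Properties using (deduplicate-!)
open import Data.Product using (Σ; _×_; _,_; proj₁; proj₂)
open import Data.Sum using (_⊎_; inj₁; inj₂)
open import Data.Empty using (⊥)
open import Relation.Nullary using (Dec; yes; no)
open import Relation.Nullary.Decidable using (_×-dec_)
open import Relation.Binary.Definitions using (DecidableEquality)
open import Relation.Binary.PropositionalEquality as ≡ using (_≡_; refl; cong; subst)

module _ {V : Set} {R : V → V → Set} where

  snoc : ∀ {u v w k} → Walk R u v k → R v w → Walk R u w (suc k)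
  snoc nil e = cons e nil
  snoc (cons e′ p) e = cons e′ (snoc p e)

  onWalk-end : ∀ {u v k} (p : Walk R u v k) → OnWalk R v p
  onWalk-end nil = here
  onWalk-end (cons e p) = there (onWalk-end p)

  onWalk-snoc : ∀ {x u v w k} {p : Walk R u v k} {e : R v w} → OnWalk R x p → OnWalk R x (snoc p e)
  onWalk-snoc here = here
  onWalk-snoc (there x∈p) = there (onWalk-snoc x∈p)

  reverse : (∀ {a b} → R a b → R b a) → ∀ {u v k} → Walk R u v k → Walk R v u k
  reverse R-sym nil = nil
  reverse R-sym (cons e p) = snoc (reverse R-sym p) (R-sym e)

  geodesic-tail : ∀ {u w v k} (e : R u w) (p : Walk R w v k) → IsGeodesic R (cons e p) → IsGeodesic R p
  geodesic-tail e _ geo k′ q = ≤-pred (geo (suc k′) (cons e q))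

  -- a geodesic from a vertex to itself has no arcs, so singletons are convex
  singleton-convex : ∀ x → Convex R (_≡ x)
  singleton-convex x _ (_ , _ , refl , refl , zero , nil , _ , here) = refl
  singleton-convex x _ (_ , _ , refl , refl , suc _ , _ , geo , _) with geo 0 nil
  ... | ()

  singleton-hull : ∀ {x} → IsHullSet R (x ∷ []) → ∀ y → y ≡ x
  singleton-hull {x} hull = hull (_≡ x) (singleton-convex x) λ { _ (Any.here refl) → refl }

  hull-dedup : (_≟_ : DecidableEquality V) → ∀ T → IsHullSet R T → IsHullSet R (deduplicate _≟_ T)
  hull-dedup _≟_ T hull C convex T⊆C = hull C convex λ t t∈T → T⊆C t (∈-deduplicate⁺ _≟_ t∈T)

Minimum : (ℕ → Set) → Set
Minimum P = Σ ℕ λ k → P k × (∀ j → P j → k ≤ j)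

least-witness : {P : ℕ → Set} → (∀ k → Dec (P k)) → ∀ K → P K → Minimum P
least-witness {P} P? = <-rec (λ K → P K → Minimum P) search
  where
  search : ∀ K → (∀ {j} → j < K → P j → Minimum P) → P K → Minimum P
  search K below PK with anyUpTo? P? K
  ... | yes (j , j<K , Pj) = below j<K Pj
  ... | no none = K , PK , λ j Pj → ≮⇒≥ λ j<K → none (j , j<K , Pj)

module Distance {n : ℕ} (R : Fin n → Fin n → Set) (R? : ∀ u v → Dec (R u v))
                (reachable : ∀ u v → Σ ℕ λ k → Walk R u v k) where

  walk? : ∀ k u v → Dec (Walk R u v k)
  walk? zero u v with u ≟ᶠ v
  ... | yes refl = yes nil
  ... | no u≢v = no λ { nil → u≢v refl }
  walk? (suc k) u v with any? (λ w → R? u w ×-dec walk? k w v)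
  ... | yes (w , e , p) = yes (cons e p)
  ... | no none = no λ { (cons e p) → none (_ , e , p) }

  -- dist is used only through its two defining properties, geodesic and
  -- dist-minimal (kept opaque so that it is never unfolded)
  opaque
    shortest : ∀ u v → Minimum (Walk R u v)
    shortest u v = least-witness (λ k → walk? k u v) (proj₁ (reachable u v)) (proj₂ (reachable u v))

    dist : Fin n → Fin n → ℕ
    dist u v = proj₁ (shortest u v)

    geodesic : ∀ u v → Walk R u v (dist u v)
    geodesic u v = proj₁ (proj₂ (shortest u v))

    dist-minimal : ∀ {u v k} → Walk R u v k → dist u v ≤ k
    dist-minimal {u} {v} = proj₂ (proj₂ (shortest u v)) _

  dist-sym : (∀ {a b} → R a b → R b a) → ∀ u v → dist u v ≡ dist v u
  dist-sym R-sym u v = ≤-antisym (dist-minimal (reverse R-sym (geodesic v u)))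
                                 (dist-minimal (reverse R-sym (geodesic u v)))

Near : ∀ {n} → Graph n → Fin n → Fin n → Set
Near G b c = b ≡ c ⊎ Edge G b c

edge-sym : ∀ {n} (G : Graph n) {u v} → Edge G u v → Edge G v u
edge-sym G {u} {v} e = ≡.trans (sym G v u) e

near-sym : ∀ {n} (G : Graph n) {b c} → Near G b c → Near G c b
near-sym G (inj₁ b≡c) = inj₁ (≡.sym b≡c)
near-sym G (inj₂ e) = inj₂ (edge-sym G e)

module BipartiteDistance {n} (G : Graph n) (connected : Connected G) (bipartite : Bipartite G) where

  open Distance (Edge G) (λ u v → adj G u v ≟ᴮ true) connected public

  colour : Fin n → Bool
  colour = proj₁ bipartite

  toggle : ℕ → Bool → Bool
  toggle zero b = b
  toggle (suc k) b = toggle k (not b)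

  edge-colour : ∀ {u w} → Edge G u w → colour w ≡ not (colour u)
  edge-colour e = ¬-not (proj₂ bipartite _ _ (edge-sym G e))

  walk-colour : ∀ {u v k} → Walk (Edge G) u v k → colour v ≡ toggle k (colour u)
  walk-colour nil = refl
  walk-colour (cons {k = k} e p) = ≡.trans (walk-colour p) (cong (toggle k) (edge-colour e))

  equal-walks-not-adjacent : ∀ {s o a k} → Walk (Edge G) s o k → Walk (Edge G) s a k → Edge G o a → ⊥
  equal-walks-not-adjacent p q e =
    not-¬ (≡.trans (walk-colour q) (≡.sym (walk-colour p))) (edge-colour e)

  -- descent: a neighbour o of a ∈ C no farther than a from s ∈ C lies in C,
  -- since then d(s,a) = d(s,o) + 1 and o is on a geodesic from s to a
  descend : ∀ {C s a o} → Convex (Edge G) C → C s → C a → Near G o a → dist s o ≤ dist s a → C o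
  descend _ _ a∈C (inj₁ refl) _ = a∈C
  descend {s = s} {a} {o} convex s∈C a∈C (inj₂ e) o≤a =
    convex o (s , a , s∈C , a∈C , suc (dist s o) , via-o , via-o-geodesic , onWalk-snoc (onWalk-end (geodesic s o)))
    where
    via-o : Walk (Edge G) s a (suc (dist s o))
    via-o = snoc (geodesic s o) e
    distinct : dist s o ≡ dist s a → ⊥
    distinct eq = equal-walks-not-adjacent (geodesic s o) (subst (Walk (Edge G) s a) (≡.sym eq) (geodesic s a)) e
    one-more : dist s a ≡ suc (dist s o)
    one-more = ≤-antisym (dist-minimal via-o) (≤∧≢⇒< o≤a distinct)
    via-o-geodesic : IsGeodesic (Edge G) via-o
    via-o-geodesic k′ q = subst (_≤ k′) one-more (dist-minimal q)

opaque
  argmax : {A : Set} → (A → ℕ) → A → A → A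
  argmax f b c with f b ≤? f c
  ... | yes _ = c
  ... | no _ = b

  argmax-cases : ∀ {A : Set} (f : A → ℕ) b c →
                 (argmax f b c ≡ c × f b ≤ f c) ⊎ (argmax f b c ≡ b × f c ≤ f b)
  argmax-cases f b c with f b ≤? f c
  ... | yes b≤c = inj₁ (refl , b≤c)
  ... | no b≰c = inj₂ (refl , ≰⇒≥ b≰c)

argmax-either : ∀ {A : Set} (f : A → ℕ) b c → argmax f b c ≡ b ⊎ argmax f b c ≡ c
argmax-either f b c with argmax-cases f b c
... | inj₁ (eq , _) = inj₂ eq
... | inj₂ (eq , _) = inj₁ eq

argmax-bound : ∀ {A : Set} (f : A → ℕ) b c {y} → y ≡ b ⊎ y ≡ c → f y ≤ f (argmax f b c)
argmax-bound f b c y∈bc with argmax-cases f b c | y∈bc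
... | inj₁ (eq , b≤c) | inj₁ refl = subst (λ m → f b ≤ f m) (≡.sym eq) b≤c
... | inj₁ (eq , _)   | inj₂ refl = ≤-reflexive (cong f (≡.sym eq))
... | inj₂ (eq , _)   | inj₁ refl = ≤-reflexive (cong f (≡.sym eq))
... | inj₂ (eq , c≤b) | inj₂ refl = subst (λ m → f c ≤ f m) (≡.sym eq) c≤b

module C4 {n} (G : Graph n) where

  E : Fin n → Fin n → Set
  E = Edge G

  D : C4Vertex G → C4Vertex G → Set
  D = C4Arc G

  src tgt : C4Vertex G → Fin n
  src (base i) = i
  src (sub i j _) = i
  tgt (base i) = i
  tgt (sub i j _) = j

  ends-near : ∀ z → Near G (src z) (tgt z)
  ends-near (base i) = inj₁ refl
  ends-near (sub i j e) = inj₂ e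

  Lift : (Fin n → Set) → C4Vertex G → Set
  Lift C z = C (src z) × C (tgt z)

  offset : C4Vertex G → ℕ
  offset (base _) = 0
  offset (sub _ _ _) = 1

  approach : ∀ z → Walk D (base (src z)) z (offset z)
  approach (base i) = nil
  approach (sub i j e) = cons (out i j e) nil

  -- each edge of G becomes two arcs of G_{C4}
  twice : ℕ → ℕ
  twice zero = zero
  twice (suc m) = suc (suc (twice m))

  twice-cancel : ∀ {m m′} → twice m ≤ twice m′ → m ≤ m′
  twice-cancel {zero} _ = z≤n
  twice-cancel {suc m} {suc m′} le = s≤s (twice-cancel (≤-pred (≤-pred le)))

  prepend : ∀ {i l m v k} → Walk E i l m → Walk D (base l) v k → Walk D (base i) v (twice m + k)
  prepend nil r = r
  prepend (cons e q) r = cons (out _ _ e) (cons (inn _ _ e) (prepend q r))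

  record Projection {i v k} (p : Walk D (base i) v k) : Set where
    field
      len    : ℕ
      len-eq : k ≡ twice len + offset v
      walk   : Walk E i (src v) len
      covers : ∀ {x} → OnWalk D x p → x ≡ v ⊎ (OnWalk E (src x) walk × OnWalk E (tgt x) walk)

  project : ∀ {i v k} (p : Walk D (base i) v k) → Projection p
  project nil = record { len = 0 ; len-eq = refl ; walk = nil ; covers = λ { here → inj₁ refl } }
  project (cons (out i j e) nil) =
    record { len = 0 ; len-eq = refl ; walk = nil
           ; covers = λ { here → inj₂ (here , here) ; (there here) → inj₁ refl } }
  project {v = v} (cons (out i j e) (cons (inn _ _ _) p)) =
    record { len = suc len ; len-eq = cong (λ t → suc (suc t)) len-eq ; walk = cons e walk ; covers = covers′ }
    where
    open Projection (project p)
    covers′ : ∀ {x} → OnWalk D x (cons (out i j e) (cons (inn i j e) p)) →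
              x ≡ v ⊎ (OnWalk E (src x) (cons e walk) × OnWalk E (tgt x) (cons e walk))
    covers′ here = inj₂ (here , here)
    covers′ (there here) = inj₂ (here , there here)
    covers′ (there (there x∈p)) with covers x∈p
    ... | inj₁ x≡v = inj₁ x≡v
    ... | inj₂ (s∈q , t∈q) = inj₂ (there s∈q , there t∈q)

  geodesic-from-base : ∀ {C i v k x} → Convex E C → (p : Walk D (base i) v k) → IsGeodesic D p →
                       C i → Lift C v → OnWalk D x p → Lift C x
  geodesic-from-base {C} {i} {v} convex p geo i∈C v∈C x∈p with Projection.covers (project p) x∈p
  ... | inj₁ refl = v∈C
  ... | inj₂ (s∈q , t∈q) = on-walk s∈q , on-walk t∈q
    where
    open Projection (project p)
    walk-geodesic : IsGeodesic E walk
    walk-geodesic m′ q = twice-cancel (+-cancelʳ-≤ (offset v) _ _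
                           (subst (_≤ _) len-eq (geo _ (prepend q (approach v)))))
    on-walk : ∀ {w} → OnWalk E w walk → C w
    on-walk w∈q = convex _ (i , src v , i∈C , proj₁ v∈C , len , walk , walk-geodesic , w∈q)

  -- lifts of convex sets are convex: a geodesic starting at v_{i,j} enters
  -- v_j at its first arc and is a geodesic from v_j from there on
  lift-convex : ∀ {C} → Convex E C → Convex D (Lift C)
  lift-convex {C} convex x (u , v , u∈C , v∈C , k , p , geo , x∈p) = from u p geo u∈C x∈p
    where
    from : ∀ {k} u (p : Walk D u v k) → IsGeodesic D p → Lift C u → OnWalk D x p → Lift C x
    from (base i) p geo u∈C x∈p = geodesic-from-base convex p geo (proj₁ u∈C) v∈C x∈p
    from (sub _ _ _) nil _ u∈C here = u∈C
    from (sub _ _ _) (cons (inn _ _ _) _) _ u∈C here = u∈C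
    from (sub i j e) (cons (inn _ _ _) p) geo u∈C (there x∈p) =
      geodesic-from-base convex p (geodesic-tail (inn i j e) p geo) (proj₂ u∈C) v∈C x∈p

module HullProjection {n} (G : Graph n) (connected : Connected G) (bipartite : Bipartite G) where

  open BipartiteDistance G connected bipartite
  open C4 G

  Covers : List (Fin n) → List (C4Vertex G) → Set₁
  Covers T S = ∀ C → Convex E C → (∀ t → t ∈ T → C t) → ∀ z → z ∈ S → Lift C z

  covers-hull : ∀ {S T} → IsHullSet D S → Covers T S → IsHullSet E T
  covers-hull hull cover C convex T⊆C v = proj₁ (hull (Lift C) (lift-convex convex) (cover C convex T⊆C) (base v))

  far : Fin n → C4Vertex G → Fin n
  far a z = argmax (dist a) (src z) (tgt z)

  reach : C4Vertex G → Fin n → ℕ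
  reach y a = dist a (far a y)

  -- from a and the far endpoint of z, descent recovers the near one
  recover-far : ∀ {C a} z → Convex E C → C a → C (far a z) → Lift C z
  recover-far {C} {a} z convex a∈C far∈C with argmax-cases (dist a) (src z) (tgt z)
  ... | inj₁ (eq , le) = let tgt∈C = subst C eq far∈C in
                         descend convex a∈C tgt∈C (ends-near z) le , tgt∈C
  ... | inj₂ (eq , le) = let src∈C = subst C eq far∈C in
                         src∈C , descend convex a∈C src∈C (near-sym G (ends-near z)) le

  -- an endpoint o next to a ∈ C that reaches y no farther than a does is
  -- recovered from the far endpoint s of y from a: d(s,o) ≤ reach y o ≤ reach y a = d(s,a)
  recover-near : ∀ {C a o} y → Convex E C → Near G o a → reach y o ≤ reach y a → C a → C (far a y) → C o
  recover-near {a = a} {o} y convex near o≤a a∈C s∈C = descend convex s∈C a∈C near (begin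
      dist s o   ≡⟨ dist-sym (edge-sym G) s o ⟩
      dist o s   ≤⟨ argmax-bound (dist o) (src y) (tgt y) (argmax-either (dist a) (src y) (tgt y)) ⟩
      reach y o  ≤⟨ o≤a ⟩
      reach y a  ≡⟨ dist-sym (edge-sym G) a s ⟩
      dist s a   ∎)
    where
    open ≤-Reasoning
    s = far a y

  anchor : C4Vertex G → C4Vertex G → Fin n
  anchor x y = argmax (reach y) (src x) (tgt x)

  recover-anchor : ∀ {C} x y → Convex E C → C (anchor x y) → C (far (anchor x y) y) → Lift C x
  recover-anchor {C} x y convex anchor∈C far∈C with argmax-cases (reach y) (src x) (tgt x)
  ... | inj₁ (eq , le) = let tgt∈C = subst C eq anchor∈C in
    recover-near y convex (ends-near x) le tgt∈C (subst (λ a → C (far a y)) eq far∈C) , tgt∈C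
  ... | inj₂ (eq , le) = let src∈C = subst C eq anchor∈C in
    src∈C , recover-near y convex (near-sym G (ends-near x)) le src∈C (subst (λ a → C (far a y)) eq far∈C)

  certificate : C4Vertex G → C4Vertex G → List (C4Vertex G) → List (Fin n)
  certificate x y rest = anchor x y ∷ map (far (anchor x y)) (y ∷ rest)

  certificate-covers : ∀ x y rest → Covers (certificate x y rest) (x ∷ y ∷ rest)
  certificate-covers x y _ C convex T⊆C _ (Any.here refl) =
    recover-anchor x y convex (T⊆C _ (Any.here refl)) (T⊆C _ (Any.there (Any.here refl)))
  certificate-covers x y rest C convex T⊆C z (Any.there z∈S) =
    recover-far z convex (T⊆C _ (Any.here refl)) (T⊆C _ (Any.there (∈-map⁺ (far (anchor x y)) z∈S)))

  covering-list : ∀ S → IsHullSet D S → Σ (List (Fin n)) λ T → Covers T S × length T ≤ length S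
  covering-list [] _ = [] , (λ { _ _ _ _ () }) , z≤n
  covering-list (x ∷ []) hull = src x ∷ [] , cover , ≤-refl
    where
    -- x is the only vertex of G_{C4}, so x = v_{src x}
    cover : Covers (src x ∷ []) (x ∷ [])
    cover C _ T⊆C _ (Any.here refl) = let s∈C = T⊆C _ (Any.here refl) in
      subst (Lift C) (singleton-hull hull (base (src x))) (s∈C , s∈C)
  covering-list (x ∷ y ∷ rest) _ =
    certificate x y rest , certificate-covers x y rest ,
    ≤-reflexive (cong suc (length-map (far (anchor x y)) (y ∷ rest)))

  hull-set-projection : ∀ S → IsHullSet D S →
                        Σ (List (Fin n)) λ T → Unique T × IsHullSet E T × length T ≤ length S
  hull-set-projection S hull with covering-list S hull
  ... | T , cover , T≤S =
    deduplicate _≟ᶠ_ T , deduplicate-! _≟ᶠ_ T , hull-dedup _≟ᶠ_ T (covers-hull hull cover) ,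
    ≤-trans (length-deduplicate _≟ᶠ_ T) T≤S

lemma4 : ∀ {n} (G : Graph n) → Connected G → Bipartite G →
    ∀ (a b : ℕ) → IsHullNumber (Edge G) a → IsHullNumber (C4Arc G) b → a ≤ b
lemma4 G connected bipartite a b (_ , a-minimal) ((S , _ , |S|≡b , S-hull) , _)
  with HullProjection.hull-set-projection G connected bipartite S S-hull
... | T , T-unique , T-hull , |T|≤|S| = subst (a ≤_) |S|≡b (≤-trans (a-minimal T T-unique T-hull) |T|≤|S|)
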